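{- Let $G_1$ and $G_2$ be vertex-disjoint threshold graphs with split partitions $C\uplus I$ and $C'\uplus I'$ respectively. Let $G_1\bowtie G_2$ be the graph with vertex set $V(G_1)\cup V(G_2)$ and edge set $E(G_1)\cup E(G_2)\cup\{uv : u\in C, v\in C'\}$. Then $G_1\bowtie G_2$ is an interval graph.
   Context: All graphs are finite, simple and undirected. A split partition of a graph is a partition $C\uplus I$ of its vertex set into a clique $C$ and an independent set $I$ (either possibly empty). A graph $G$ is a threshold graph if there exist a real number $t$ and a map $f: V(G)\to\mathbb{R}$ such that distinct $u,v$ are adjacent iff $f(u)+f(v)\ge t$; threshold graphs are split graphs. A graph is an interval graph if its vertices can be assigned intervals of the real line so that two vertices are adjacent iff their intervals intersect.
   Formalization: The weights f and the threshold t defining threshold graphs are rational rather than real, and the endpoints of the intervals representing G₁ ⋈ G₂ are taken in ℚ. -}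

module Defs where

open import Data.Bool using (Bool; true; false; _∧_; not)
open import Data.Fin using (Fin)
open import Data.Sum using (_⊎_; inj₁; inj₂)
open import Data.Product using (_×_; ∃-syntax; Σ-syntax)
open import Data.Rational using (ℚ; _≤_; _+_)
open import Relation.Binary.PropositionalEquality using (_≡_; _≢_)
open import Relation.Nullary using (¬_)
open import Function.Bundles using (_⇔_)

record Graph (V : Set) : Set where
  field
    adj    : V → V → Bool
    sym    : ∀ u v → adj u v ≡ adj v u
    irrefl : ∀ v → adj v v ≡ false

open Graph public

Edge : {V : Set} → Graph V → V → V → Set
Edge G u v = adj G u v ≡ true

record IsSplitPartition {V : Set} (G : Graph V) (inC : V → Bool) : Set where
  field
    clique      : ∀ u v → u ≢ v → inC u ≡ true → inC v ≡ true → Edge G u v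
    independent : ∀ u v → inC u ≡ false → inC v ≡ false → ¬ Edge G u v

IsThreshold : {V : Set} → Graph V → Set
IsThreshold {V} G =
  Σ[ f ∈ (V → ℚ) ] Σ[ t ∈ ℚ ]
    (∀ u v → u ≢ v → (Edge G u v ⇔ (t ≤ f u + f v)))

IsInterval : {V : Set} → Graph V → Set
IsInterval {V} G =
  Σ[ l ∈ (V → ℚ) ] Σ[ r ∈ (V → ℚ) ]
    ((∀ v → l v ≤ r v) ×
     (∀ u v → u ≢ v →
        (Edge G u v ⇔ (∃[ x ] ((l u ≤ x × x ≤ r u) × (l v ≤ x × x ≤ r v))))))

joinAdj : {V W : Set} → Graph V → Graph W → (V → Bool) → (W → Bool) →
          V ⊎ W → V ⊎ W → Bool
joinAdj G₁ G₂ c c' (inj₁ u) (inj₁ v) = adj G₁ u v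
joinAdj G₁ G₂ c c' (inj₂ u) (inj₂ v) = adj G₂ u v
joinAdj G₁ G₂ c c' (inj₁ u) (inj₂ v) = c u ∧ c' v
joinAdj G₁ G₂ c c' (inj₂ u) (inj₁ v) = c v ∧ c' u

joinSym : {V W : Set} (G₁ : Graph V) (G₂ : Graph W) (c : V → Bool) (c' : W → Bool) →
          ∀ x y → joinAdj G₁ G₂ c c' x y ≡ joinAdj G₁ G₂ c c' y x
joinSym G₁ G₂ c c' (inj₁ u) (inj₁ v) = sym G₁ u v
joinSym G₁ G₂ c c' (inj₂ u) (inj₂ v) = sym G₂ u v
joinSym G₁ G₂ c c' (inj₁ u) (inj₂ v) = _≡_.refl
joinSym G₁ G₂ c c' (inj₂ u) (inj₁ v) = _≡_.refl

joinIrrefl : {V W : Set} (G₁ : Graph V) (G₂ : Graph W) (c : V → Bool) (c' : W → Bool) →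
             ∀ x → joinAdj G₁ G₂ c c' x x ≡ false
joinIrrefl G₁ G₂ c c' (inj₁ u) = irrefl G₁ u
joinIrrefl G₁ G₂ c c' (inj₂ u) = irrefl G₂ u

join : {V W : Set} → Graph V → Graph W → (V → Bool) → (W → Bool) → Graph (V ⊎ W)
join G₁ G₂ c c' = record
  { adj = joinAdj G₁ G₂ c c'
  ; sym = joinSym G₁ G₂ c c'
  ; irrefl = joinIrrefl G₁ G₂ c c' }

-- In a threshold graph with split partition C ⊎ I, an independent vertex u is adjacent to a
-- clique vertex c iff t - f u ≤ f c, so the neighbourhoods in C of the vertices of I are nested.
-- Replacing each rational q by its rank, the number of clique vertices of weight below q,
-- put every clique vertex c on [0, rank (f c)] and every independent vertex u on the point
-- rank (t - f u), spread out so that distinct independent vertices get distinct positive points.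
-- Exactly the clique vertices contain 0, so mirroring the model of G₂ to the negative axis makes
-- the two cliques, and nothing else, meet at 0.
module Submission where

open import Defs hiding (sym)
open import Level using (0ℓ)
open import Data.Nat as ℕ using (ℕ; zero; suc; z≤n; s≤s)
import Data.Nat.Properties as ℕ
open import Data.Nat.DivMod using (_%_; [m+kn]%n≡m%n; m≤n⇒m%n≡m)
open import Data.Integer as ℤ using (ℤ; +_; -_; +≤+)
import Data.Integer.Properties as ℤ
open import Data.Rational as ℚ using (ℚ; _-_; _<?_; *≤*)
import Data.Rational.Properties as ℚ
open import Data.Rational.Literals using (fromℤ)
open import Data.Fin using (Fin; toℕ)
open import Data.Fin.Properties using (toℕ-injective; toℕ<n)
open import Data.Fin.Subset using (Subset; _∈_; _⊆_; _⊂_; ∣_∣)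
open import Data.Fin.Subset.Properties using (p⊆q⇒∣p∣≤∣q∣; p⊂q⇒∣p∣<∣q∣)
open import Data.Vec using (tabulate)
open import Data.Vec.Properties using ([]=⇒lookup; lookup⇒[]=; lookup∘tabulate)
open import Data.Bool using (Bool; true; false; _∧_; if_then_else_)
open import Data.Bool.Properties using (T-≡; T-∧)
open import Data.Product using (_×_; _,_; proj₁; proj₂; swap; ∃-syntax)
open import Data.Product.Function.NonDependent.Propositional using (_×-⇔_)
open import Data.Sum using (_⊎_; inj₁; inj₂)
open import Data.Empty using (⊥-elim)
open import Function using (_∘_)
open import Function.Bundles using (_⇔_; mk⇔; Equivalence)
open import Function.Properties.Equivalence using (⇔-setoid)
import Function.Properties.Equivalence as ⇔
open import Relation.Nullary using (Dec; yes; no; does)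
open import Relation.Nullary.Decidable using (dec-true)
open import Relation.Binary.PropositionalEquality
import Relation.Binary.Reasoning.Setoid as SetoidReasoning

open Equivalence using (to; from)

module ⇔-Reasoning = SetoidReasoning (⇔-setoid 0ℓ)

×-comm⇔ : ∀ {A B : Set} → (A × B) ⇔ (B × A)
×-comm⇔ = mk⇔ swap swap

Edge-sym : ∀ {V : Set} (G : Graph V) {u v : V} → Edge G u v ⇔ Edge G v u
Edge-sym G {u} {v} = mk⇔ (trans (Graph.sym G v u)) (trans (Graph.sym G u v))

∧≡true⇔ : ∀ {x y} → (x ∧ y ≡ true) ⇔ (x ≡ true × y ≡ true)
∧≡true⇔ = ⇔.trans (⇔.sym T-≡) (⇔.trans T-∧ (T-≡ ×-⇔ T-≡))

does≡true⇔ : ∀ {P : Set} (P? : Dec P) → (does P? ≡ true) ⇔ P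
does≡true⇔ P? = mk⇔ (witness P?) (dec-true P?)
  where
  witness : ∀ {P : Set} (P? : Dec P) → does P? ≡ true → P
  witness (yes p) _ = p

∈-tabulate⇔ : ∀ {m} {g : Fin m → Bool} {i : Fin m} → (i ∈ tabulate g) ⇔ (g i ≡ true)
∈-tabulate⇔ {g = g} {i} =
  mk⇔ (λ i∈ → trans (sym (lookup∘tabulate g i)) ([]=⇒lookup i∈))
      (λ gi → lookup⇒[]= i (tabulate g) (trans (lookup∘tabulate g i) gi))

≤+⇔-≤ : ∀ {p q r : ℚ} → (p ℚ.≤ q ℚ.+ r) ⇔ (p - q ℚ.≤ r)
≤+⇔-≤ {p} {q} {r} = mk⇔
  (λ p≤q+r → subst (p - q ℚ.≤_) (xyx⁻¹≈y q r) (ℚ.+-monoˡ-≤ (ℚ.- q) p≤q+r))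
  (λ p-q≤r → subst₂ ℚ._≤_ (//-rightDividesˡ q p) (ℚ.+-comm r q) (ℚ.+-monoˡ-≤ q p-q≤r))
  where
  open import Algebra.Properties.AbelianGroup ℚ.+-0-abelianGroup using (xyx⁻¹≈y; //-rightDividesˡ)

fromℤ-≤⇔ : ∀ {i j : ℤ} → (i ℤ.≤ j) ⇔ (fromℤ i ℚ.≤ fromℤ j)
fromℤ-≤⇔ {i} {j} = mk⇔
  (λ i≤j → *≤* (subst₂ ℤ._≤_ (sym (ℤ.*-identityʳ i)) (sym (ℤ.*-identityʳ j)) i≤j))
  (λ { (*≤* i≤j) → subst₂ ℤ._≤_ (ℤ.*-identityʳ i) (ℤ.*-identityʳ j) i≤j })

closedIntervals-meet⇔ : ∀ {a b c d : ℚ} → a ℚ.≤ b → c ℚ.≤ d →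
  (a ℚ.≤ d × c ℚ.≤ b) ⇔ (∃[ x ] ((a ℚ.≤ x × x ℚ.≤ b) × (c ℚ.≤ x × x ℚ.≤ d)))
closedIntervals-meet⇔ {a} {b} {c} {d} a≤b c≤d = mk⇔ meet
  (λ (_ , (a≤x , x≤b) , (c≤x , x≤d)) → ℚ.≤-trans a≤x x≤d , ℚ.≤-trans c≤x x≤b)
  where
  meet : a ℚ.≤ d × c ℚ.≤ b → ∃[ x ] ((a ℚ.≤ x × x ℚ.≤ b) × (c ℚ.≤ x × x ℚ.≤ d))
  meet (a≤d , c≤b) with ℚ.≤-total a c
  ... | inj₁ a≤c = c , (a≤c , c≤b) , (ℚ.≤-refl , c≤d)
  ... | inj₂ c≤a = a , (ℚ.≤-refl , a≤b) , (c≤a , a≤d)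

+≤+⇔ : ∀ {a b : ℕ} → (+ a ℤ.≤ + b) ⇔ (a ℕ.≤ b)
+≤+⇔ = mk⇔ ℤ.drop‿+≤+ +≤+

-+≤-+⇔ : ∀ {a b : ℕ} → (- (+ a) ℤ.≤ - (+ b)) ⇔ (b ℕ.≤ a)
-+≤-+⇔ = ⇔.trans (mk⇔ ℤ.neg-cancel-≤ ℤ.neg-mono-≤) +≤+⇔

+≤-+⇔≡0 : ∀ {a b : ℕ} → (+ a ℤ.≤ - (+ b)) ⇔ (a ≡ 0 × b ≡ 0)
+≤-+⇔≡0 = mk⇔ zeros (λ { (refl , refl) → +≤+ z≤n })
  where
  zeros : ∀ {a b} → + a ℤ.≤ - (+ b) → a ≡ 0 × b ≡ 0
  zeros {zero}  {zero} _ = refl , refl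
  zeros {suc a} {zero} (+≤+ ())
  zeros {b = suc b} ()

radix-≤⇔ : ∀ {m i k h} → i ℕ.≤ m →
  (i ℕ.+ k ℕ.* suc m ℕ.≤ m ℕ.+ h ℕ.* suc m) ⇔ (k ℕ.≤ h)
radix-≤⇔ {m} {i} {k} {h} i≤m =
  mk⇔ leading (λ k≤h → ℕ.+-mono-≤ i≤m (ℕ.*-monoˡ-≤ (suc m) k≤h))
  where
  leading : i ℕ.+ k ℕ.* suc m ℕ.≤ m ℕ.+ h ℕ.* suc m → k ℕ.≤ h
  leading ≤ with ℕ.≤-<-connex k h
  ... | inj₁ k≤h = k≤h
  ... | inj₂ h<k = ⊥-elim (ℕ.<⇒≱ (ℕ.<-≤-trans (ℕ.+-monoˡ-< (h ℕ.* suc m) (ℕ.n<1+n m))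
                            (ℕ.≤-trans (ℕ.*-monoˡ-≤ (suc m) h<k) (ℕ.m≤n+m (k ℕ.* suc m) i))) ≤)

radix-injective : ∀ {m i j k h} → i ℕ.≤ m → j ℕ.≤ m →
  i ℕ.+ k ℕ.* suc m ≡ j ℕ.+ h ℕ.* suc m → i ≡ j
radix-injective {m} {i} {j} {k} {h} i≤m j≤m eq = begin
  i                           ≡⟨ m≤n⇒m%n≡m i≤m ⟨
  i % suc m                   ≡⟨ [m+kn]%n≡m%n i k (suc m) ⟨
  (i ℕ.+ k ℕ.* suc m) % suc m ≡⟨ cong (_% suc m) eq ⟩
  (j ℕ.+ h ℕ.* suc m) % suc m ≡⟨ [m+kn]%n≡m%n j h (suc m) ⟩
  j % suc m                   ≡⟨ m≤n⇒m%n≡m j≤m ⟩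
  j                           ∎
  where open ≡-Reasoning

module Rank {m : ℕ} (S : Fin m → Bool) (w : Fin m → ℚ) where

  below : ℚ → Subset m
  below q = tabulate (λ i → S i ∧ does (w i <? q))

  rank : ℚ → ℕ
  rank q = ∣ below q ∣

  ∈-below⇔ : ∀ {q i} → (i ∈ below q) ⇔ (S i ≡ true × w i ℚ.< q)
  ∈-below⇔ {q} {i} =
    ⇔.trans ∈-tabulate⇔ (⇔.trans ∧≡true⇔ (⇔.refl ×-⇔ does≡true⇔ (w i <? q)))

  below-mono : ∀ {p q} → p ℚ.≤ q → below p ⊆ below q
  below-mono p≤q i∈ with to ∈-below⇔ i∈
  ... | Si , wi<p = from ∈-below⇔ (Si , ℚ.<-≤-trans wi<p p≤q)

  below-⊂ : ∀ {q i} → S i ≡ true → w i ℚ.< q → below (w i) ⊂ below q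
  below-⊂ {q} {i} Si wi<q = below-mono (ℚ.<⇒≤ wi<q) , i , from ∈-below⇔ (Si , wi<q) ,
                            ℚ.<-irrefl refl ∘ proj₂ ∘ to ∈-below⇔

  -- The weights of S-members are exactly the rational numbers at which the rank jumps.
  ≤-weight⇔rank : ∀ {q i} → S i ≡ true → (q ℚ.≤ w i) ⇔ (rank q ℕ.≤ rank (w i))
  ≤-weight⇔rank {q} {i} Si = mk⇔ (p⊆q⇒∣p∣≤∣q∣ ∘ below-mono) reflect
    where
    reflect : rank q ℕ.≤ rank (w i) → q ℚ.≤ w i
    reflect r≤ with q ℚ.≤? w i
    ... | yes q≤wi = q≤wi
    ... | no q≰wi = ⊥-elim (ℕ.<⇒≱ (p⊂q⇒∣p∣<∣q∣ (below-⊂ Si (ℚ.≰⇒> q≰wi))) r≤)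

record AnchoredIntervalModel {V : Set} (G : Graph V) (inC : V → Bool) : Set where
  field
    lo hi        : V → ℕ
    lo≤hi        : ∀ v → lo v ℕ.≤ hi v
    edge⇔overlap : ∀ u v → u ≢ v → Edge G u v ⇔ (lo u ℕ.≤ hi v × lo v ℕ.≤ hi u)
    lo≡0⇔inC     : ∀ v → (lo v ≡ 0) ⇔ (inC v ≡ true)

isInterval-fromℤ : {V : Set} (G : Graph V) (l r : V → ℤ) → (∀ v → l v ℤ.≤ r v) →
  (∀ u v → u ≢ v → Edge G u v ⇔ (l u ℤ.≤ r v × l v ℤ.≤ r u)) → IsInterval G
isInterval-fromℤ G l r l≤r edge⇔ =
  fromℤ ∘ l , fromℤ ∘ r , (to fromℤ-≤⇔ ∘ l≤r) ,
  λ u v u≢v → ⇔.trans (edge⇔ u v u≢v)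
                (⇔.trans (fromℤ-≤⇔ ×-⇔ fromℤ-≤⇔)
                         (closedIntervals-meet⇔ (to fromℤ-≤⇔ (l≤r u)) (to fromℤ-≤⇔ (l≤r v))))

join-isInterval : {V W : Set} {G₁ : Graph V} {G₂ : Graph W} {C : V → Bool} {C' : W → Bool} →
  AnchoredIntervalModel G₁ C → AnchoredIntervalModel G₂ C' → IsInterval (join G₁ G₂ C C')
join-isInterval {G₁ = G₁} {G₂} {C} {C'} M₁ M₂ =
  isInterval-fromℤ (join G₁ G₂ C C') l r l≤r edge⇔
  where
  module M₁ = AnchoredIntervalModel M₁
  module M₂ = AnchoredIntervalModel M₂

  l r : _ ⊎ _ → ℤ
  l (inj₁ u) = + M₁.lo u
  l (inj₂ v) = - (+ M₂.hi v)
  r (inj₁ u) = + M₁.hi u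
  r (inj₂ v) = - (+ M₂.lo v)

  l≤r : ∀ x → l x ℤ.≤ r x
  l≤r (inj₁ u) = from +≤+⇔ (M₁.lo≤hi u)
  l≤r (inj₂ v) = from -+≤-+⇔ (M₂.lo≤hi v)

  cross⇔ : ∀ u v →
    (C u ∧ C' v ≡ true) ⇔ (l (inj₁ u) ℤ.≤ r (inj₂ v) × l (inj₂ v) ℤ.≤ r (inj₁ u))
  cross⇔ u v = begin
    (C u ∧ C' v ≡ true)              ≈⟨ ∧≡true⇔ ⟩
    (C u ≡ true × C' v ≡ true)       ≈⟨ ⇔.sym (M₁.lo≡0⇔inC u ×-⇔ M₂.lo≡0⇔inC v) ⟩
    (M₁.lo u ≡ 0 × M₂.lo v ≡ 0)      ≈⟨ ⇔.sym +≤-+⇔≡0 ⟩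
    (+ M₁.lo u ℤ.≤ - (+ M₂.lo v))    ≈⟨ mk⇔ (_, ℤ.neg-≤-pos) proj₁ ⟩
    (+ M₁.lo u ℤ.≤ - (+ M₂.lo v) × - (+ M₂.hi v) ℤ.≤ + M₁.hi u) ∎
    where open ⇔-Reasoning

  edge⇔ : ∀ x y → x ≢ y → Edge (join G₁ G₂ C C') x y ⇔ (l x ℤ.≤ r y × l y ℤ.≤ r x)
  edge⇔ (inj₁ u) (inj₁ v) x≢y =
    ⇔.trans (M₁.edge⇔overlap u v (x≢y ∘ cong inj₁)) (⇔.sym (+≤+⇔ ×-⇔ +≤+⇔))
  edge⇔ (inj₂ u) (inj₂ v) x≢y =
    ⇔.trans (M₂.edge⇔overlap u v (x≢y ∘ cong inj₂))
            (⇔.trans ×-comm⇔ (⇔.sym (-+≤-+⇔ ×-⇔ -+≤-+⇔)))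
  edge⇔ (inj₁ u) (inj₂ v) _ = cross⇔ u v
  edge⇔ (inj₂ v) (inj₁ u) _ = ⇔.trans (cross⇔ u v) ×-comm⇔

module ThresholdSplit {m : ℕ} (G : Graph (Fin m)) (C : Fin m → Bool)
  (f : Fin m → ℚ) (t : ℚ) (threshold : ∀ u v → u ≢ v → Edge G u v ⇔ (t ℚ.≤ f u ℚ.+ f v))
  (split : IsSplitPartition G C) where

  open IsSplitPartition split
  open Rank C f

  -- Independent vertices are told apart by their index, which is the low digit base suc m.
  point : Fin m → ℕ
  point u = suc (toℕ u ℕ.+ rank (t - f u) ℕ.* suc m)

  top : Fin m → ℕ
  top c = suc (m ℕ.+ rank (f c) ℕ.* suc m)

  point-injective : ∀ {u v} → point u ≡ point v → u ≡ v
  point-injective {u} {v} eq = toℕ-injective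
    (radix-injective {k = rank (t - f u)} {h = rank (t - f v)}
      (ℕ.<⇒≤ (toℕ<n u)) (ℕ.<⇒≤ (toℕ<n v)) (ℕ.suc-injective eq))

  independent≢clique : ∀ {u c} → C u ≡ false → C c ≡ true → u ≢ c
  independent≢clique Cu Cc refl with () ← trans (sym Cu) Cc

  edge⇔point≤top : ∀ {u c} → C u ≡ false → C c ≡ true → Edge G u c ⇔ (point u ℕ.≤ top c)
  edge⇔point≤top {u} {c} Cu Cc = begin
    Edge G u c                       ≈⟨ threshold u c (independent≢clique Cu Cc) ⟩
    (t ℚ.≤ f u ℚ.+ f c)              ≈⟨ ≤+⇔-≤ ⟩
    (t - f u ℚ.≤ f c)                ≈⟨ ≤-weight⇔rank Cc ⟩
    (rank (t - f u) ℕ.≤ rank (f c))  ≈⟨ ⇔.sym (radix-≤⇔ (ℕ.<⇒≤ (toℕ<n u))) ⟩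
    (toℕ u ℕ.+ rank (t - f u) ℕ.* suc m ℕ.≤ m ℕ.+ rank (f c) ℕ.* suc m)
                                     ≈⟨ mk⇔ s≤s ℕ.s≤s⁻¹ ⟩
    (point u ℕ.≤ top c)              ∎
    where open ⇔-Reasoning

  lo hi : Fin m → ℕ
  lo v = if C v then 0 else point v
  hi v = if C v then top v else point v

  lo≤hi : ∀ v → lo v ℕ.≤ hi v
  lo≤hi v with C v
  ... | true  = z≤n
  ... | false = ℕ.≤-refl

  lo≡0⇔C : ∀ v → (lo v ≡ 0) ⇔ (C v ≡ true)
  lo≡0⇔C v with C v
  ... | true  = mk⇔ (λ _ → refl) (λ _ → refl)
  ... | false = mk⇔ (λ ()) (λ ())

  edge⇔overlap : ∀ u v → u ≢ v → Edge G u v ⇔ (lo u ℕ.≤ hi v × lo v ℕ.≤ hi u)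
  edge⇔overlap u v u≢v with C u in Cu | C v in Cv
  ... | true  | true  = mk⇔ (λ _ → z≤n , z≤n) (λ _ → clique u v u≢v Cu Cv)
  ... | false | true  = ⇔.trans (edge⇔point≤top Cu Cv) (mk⇔ (_, z≤n) proj₁)
  ... | true  | false = ⇔.trans (Edge-sym G) (⇔.trans (edge⇔point≤top Cv Cu) (mk⇔ (z≤n ,_) proj₂))
  ... | false | false = mk⇔ (⊥-elim ∘ independent u v Cu Cv)
                            (λ (≤ , ≥) → ⊥-elim (u≢v (point-injective (ℕ.≤-antisym ≤ ≥))))

  anchoredIntervalModel : AnchoredIntervalModel G C
  anchoredIntervalModel = record
    { lo = lo ; hi = hi ; lo≤hi = lo≤hi ; edge⇔overlap = edge⇔overlap ; lo≡0⇔inC = lo≡0⇔C }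

proposition5 : (m n : ℕ) (G₁ : Graph (Fin m)) (G₂ : Graph (Fin n))
               (C : Fin m → Bool) (C' : Fin n → Bool) →
               IsThreshold G₁ → IsThreshold G₂ →
               IsSplitPartition G₁ C → IsSplitPartition G₂ C' →
               IsInterval (join G₁ G₂ C C')
proposition5 m n G₁ G₂ C C' (f₁ , t₁ , th₁) (f₂ , t₂ , th₂) split₁ split₂ =
  join-isInterval (ThresholdSplit.anchoredIntervalModel G₁ C f₁ t₁ th₁ split₁)
                  (ThresholdSplit.anchoredIntervalModel G₂ C' f₂ t₂ th₂ split₂)
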